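{- Let $H$ be a hole in a prereduced graph $G$. If $v$ is adjacent to every vertex of $H$, then $v$ is adjacent to all vertices of $N[H]\setminus\{v\}$.
   Context: Graphs are finite, simple, undirected. A hole is an induced cycle of length at least $4$, identified with its vertex set; $N[H]=\bigcup_{h\in H}N[h]$. A minimal forbidden set is $X\subseteq V(G)$ with $G[X]$ not an interval graph but every proper subset inducing an interval graph; $G$ is prereduced if it has no minimal forbidden set of at most $10$ vertices. -}

module Defs where

open import Data.Nat using (ℕ; suc; _≤_)
open import Data.Fin using (Fin; toℕ)
open import Data.Fin.Subset using (Subset; _∈_; _⊂_; ∣_∣)
open import Data.Product using (Σ; _×_; ∃)
open import Data.Sum using (_⊎_)
open import Relation.Nullary using (¬_; Dec)
open import Relation.Binary.PropositionalEquality using (_≡_; _≢_)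
open import Function.Bundles using (_⇔_)
open import Function.Definitions using (Injective)

record Graph (n : ℕ) : Set₁ where
  field
    Adj     : Fin n → Fin n → Set
    adj?    : ∀ u v → Dec (Adj u v)
    sym     : ∀ {u v} → Adj u v → Adj v u
    irrefl  : ∀ {u} → ¬ Adj u u

open Graph public

-- A closed interval [l , r] with natural-number endpoints (l ≤ r is required
-- of the intervals used in a representation).
Interval : Set
Interval = ℕ × ℕ

lo hi : Interval → ℕ
lo (l Data.Product., _) = l
hi (_ Data.Product., r) = r

Meet : Interval → Interval → Set
Meet I J = (lo I ≤ hi J) × (lo J ≤ hi I)

IsIntervalOn : ∀ {n} → Graph n → Subset n → Set
IsIntervalOn {n} G X =
  Σ (Fin n → Interval) λ f →
    (∀ u → u ∈ X → lo (f u) ≤ hi (f u)) ×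
    (∀ u v → u ∈ X → v ∈ X → u ≢ v → (Adj G u v ⇔ Meet (f u) (f v)))

MinimalForbidden : ∀ {n} → Graph n → Subset n → Set
MinimalForbidden G X =
  ¬ IsIntervalOn G X × (∀ Y → Y ⊂ X → IsIntervalOn G Y)

Prereduced : ∀ {n} → Graph n → Set
Prereduced G = ∀ X → MinimalForbidden G X → ¬ (∣ X ∣ ≤ 10)

Succ : ∀ {k} → Fin k → Fin k → Set
Succ {k} i j = (toℕ j ≡ suc (toℕ i)) ⊎ ((suc (toℕ i) ≡ k) × (toℕ j ≡ 0))

CycAdj : ∀ {k} → Fin k → Fin k → Set
CycAdj i j = Succ i j ⊎ Succ j i

record Hole {n} (G : Graph n) : Set where
  field
    len      : ℕ
    len≥4    : 4 ≤ len
    cyc      : Fin len → Fin n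
    cyc-inj  : Injective _≡_ _≡_ cyc
    induced  : ∀ i j → (Adj G (cyc i) (cyc j) ⇔ CycAdj i j)

open Hole public

InHole : ∀ {n} {G : Graph n} → Hole G → Fin n → Set
InHole H w = ∃ λ i → cyc H i ≡ w

InClosedNbhd : ∀ {n} {G : Graph n} → Hole G → Fin n → Set
InClosedNbhd {G = G} H w = ∃ λ i → (cyc H i ≡ w) ⊎ Adj G (cyc H i) w

-- Suppose w ∉ N[v] ∪ {v} had a neighbour h_i on H. In a prereduced graph any
-- set of at most 10 vertices is an interval graph (up to double negation: a
-- non-interval set contains a minimal forbidden one), so it suffices to find
-- a small set that is not. If w sees two hole vertices at distance two, they
-- form an induced C₄ with w and v. Otherwise w sees either an edge h_i h_{i+1}
-- but not h_{i-1}, h_{i+2}, or h_i but none of h_{i±1}, h_{i±2}; then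
-- {w, h_{i-1}, h_{i+2}}, resp. {w, h_{i-2}, h_{i+2}}, is an asteroidal triple
-- (the two hole vertices are joined through v, and w reaches each along H).

module Submission where

open import Defs
open import Data.Nat using (ℕ; zero; suc; _+_; _≤_; _<_; s≤s; _≤?_; _<?_)
open import Data.Nat.Properties
  using (≤-refl; ≤-reflexive; ≤-trans; <⇒≤; <-≤-trans; ≤-<-trans; <-asym; ≤-antisym; ≰⇒>; ≮⇒≥;
         +-suc; +-monoʳ-≤; m≤m+n; module ≤-Reasoning)
open import Data.Fin using (Fin; zero; suc; toℕ; fromℕ; fromℕ<; inject₁; #_)
open import Data.Fin.Properties using (toℕ-fromℕ; toℕ-fromℕ<; toℕ-inject₁; toℕ<n)
open import Data.Fin.Subset using (Subset; _∈_; _⊆_; _⊂_; _∪_; ⁅_⁆; ∣_∣; inside; outside; ⊥)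
open import Data.Fin.Subset.Properties
  using (∣⊥∣≡0; ∣⁅x⁆∣≡1; ∣p∣≤∣x∷p∣; x∈⁅x⁆; x∈p∪q⁺; ⊆-refl; ⊆-trans; p⊆q⇒∣p∣≤∣q∣)
open import Data.Fin.Subset.Induction using (⊂-wellFounded)
open import Data.Vec using (Vec; []; _∷_; lookup)
open import Data.Product using (_×_; _,_; proj₁; proj₂; ∃; ∃-syntax)
open import Data.Sum using (_⊎_; inj₁; inj₂)
open import Data.Empty using (⊥-elim) renaming (⊥ to Empty)
open import Function using (_∘_)
open import Function.Bundles using (Equivalence; _⇔_)
open import Induction.WellFounded using (Acc; acc)
open import Relation.Nullary using (¬_; yes; no; contradiction)
open import Relation.Nullary.Negation using (¬¬-map)
open import Relation.Binary.PropositionalEquality using (_≡_; _≢_; refl; cong) renaming (sym to ≡-sym)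

¬¬-∀-Subset : ∀ {n} (P : Subset n → Set) → (∀ Y → ¬ ¬ P Y) → ¬ ¬ (∀ Y → P Y)
¬¬-∀-Subset {zero} P ¬¬P ¬∀P = ¬¬P [] (λ p → ¬∀P λ { [] → p })
¬¬-∀-Subset {suc n} P ¬¬P ¬∀P =
  ¬¬-∀-Subset (P ∘ (inside ∷_)) (¬¬P ∘ (inside ∷_)) λ ∀P-inside →
  ¬¬-∀-Subset (P ∘ (outside ∷_)) (¬¬P ∘ (outside ∷_)) λ ∀P-outside →
  ¬∀P λ { (inside ∷ Y) → ∀P-inside Y ; (outside ∷ Y) → ∀P-outside Y }

¬¬-→-intro : {A B : Set} → (A → ¬ ¬ B) → ¬ ¬ (A → B)
¬¬-→-intro f ¬[A→B] = ¬[A→B] λ a → ⊥-elim (f a λ b → ¬[A→B] λ _ → b)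

module _ {n} (G : Graph n) where

  ¬¬-minimal-forbidden-⊆ : ∀ {X} → Acc _⊂_ X → ¬ IsIntervalOn G X →
    ¬ ¬ (∃[ Y ] (Y ⊆ X × MinimalForbidden G Y))
  ¬¬-minimal-forbidden-⊆ {X} (acc smaller) ¬X none =
    ¬¬-∀-Subset (λ Y → Y ⊂ X → IsIntervalOn G Y) proper-subsets-interval
      λ all → none (X , ⊆-refl , ¬X , all)
    where
    proper-subsets-interval : ∀ Y → ¬ ¬ (Y ⊂ X → IsIntervalOn G Y)
    proper-subsets-interval Y = ¬¬-→-intro λ Y⊂X ¬Y →
      ¬¬-minimal-forbidden-⊆ (smaller Y⊂X) ¬Y
        λ (Z , Z⊆Y , Z-minimal) → none (Z , ⊆-trans Z⊆Y (proj₁ Y⊂X) , Z-minimal)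

  prereduced⇒¬¬interval : Prereduced G → ∀ X → ∣ X ∣ ≤ 10 → ¬ ¬ IsIntervalOn G X
  prereduced⇒¬¬interval prereduced X ∣X∣≤10 ¬X =
    ¬¬-minimal-forbidden-⊆ (⊂-wellFounded X) ¬X
      λ (Y , Y⊆X , Y-minimal) → prereduced Y Y-minimal (≤-trans (p⊆q⇒∣p∣≤∣q∣ Y⊆X) ∣X∣≤10)

Independent : ∀ {n} → Graph n → Fin n → Fin n → Set
Independent G u v = u ≢ v × ¬ Adj G u v

-- The vertices are listed with positions, so that a model can be queried
-- by literal indices; repetitions in the list are allowed.
record IntervalModel {n k} (G : Graph n) (xs : Vec (Fin n) k) : Set where
  field
    I      : Fin k → Interval
    proper : ∀ i → lo (I i) ≤ hi (I i)
    meet   : ∀ i j → Adj G (lookup xs i) (lookup xs j) → Meet (I i) (I j)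
    apart  : ∀ i j → Independent G (lookup xs i) (lookup xs j) → ¬ Meet (I i) (I j)

∣p∪q∣≤∣p∣+∣q∣ : ∀ {n} (p q : Subset n) → ∣ p ∪ q ∣ ≤ ∣ p ∣ + ∣ q ∣
∣p∪q∣≤∣p∣+∣q∣ [] [] = ≤-refl
∣p∪q∣≤∣p∣+∣q∣ (inside ∷ p) (x ∷ q) =
  s≤s (≤-trans (∣p∪q∣≤∣p∣+∣q∣ p q) (+-monoʳ-≤ ∣ p ∣ (∣p∣≤∣x∷p∣ x q)))
∣p∪q∣≤∣p∣+∣q∣ (outside ∷ p) (inside ∷ q) =
  ≤-trans (s≤s (∣p∪q∣≤∣p∣+∣q∣ p q)) (≤-reflexive (≡-sym (+-suc ∣ p ∣ ∣ q ∣)))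
∣p∪q∣≤∣p∣+∣q∣ (outside ∷ p) (outside ∷ q) = ∣p∪q∣≤∣p∣+∣q∣ p q

vertices : ∀ {n k} → Vec (Fin n) k → Subset n
vertices []       = ⊥
vertices (x ∷ xs) = ⁅ x ⁆ ∪ vertices xs

∈-vertices : ∀ {n k} (xs : Vec (Fin n) k) i → lookup xs i ∈ vertices xs
∈-vertices (x ∷ xs) zero    = x∈p∪q⁺ (inj₁ (x∈⁅x⁆ x))
∈-vertices (x ∷ xs) (suc i) = x∈p∪q⁺ (inj₂ (∈-vertices xs i))

∣vertices∣≤length : ∀ {n k} (xs : Vec (Fin n) k) → ∣ vertices xs ∣ ≤ k
∣vertices∣≤length {n} []  = ≤-reflexive (∣⊥∣≡0 n)
∣vertices∣≤length (x ∷ xs) = begin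
  ∣ ⁅ x ⁆ ∪ vertices xs ∣       ≤⟨ ∣p∪q∣≤∣p∣+∣q∣ ⁅ x ⁆ (vertices xs) ⟩
  ∣ ⁅ x ⁆ ∣ + ∣ vertices xs ∣   ≡⟨ cong (_+ ∣ vertices xs ∣) (∣⁅x⁆∣≡1 x) ⟩
  suc ∣ vertices xs ∣           ≤⟨ s≤s (∣vertices∣≤length xs) ⟩
  suc _                         ∎
  where open ≤-Reasoning

module _ {n} {G : Graph n} where

  adjacent⇒distinct : ∀ {u v} → Adj G u v → u ≢ v
  adjacent⇒distinct u~v refl = irrefl G u~v

  interval-model : ∀ {k} (xs : Vec (Fin n) k) → IsIntervalOn G (vertices xs) → IntervalModel G xs
  interval-model xs (f , f-proper , adj⇔meet) = record
    { I      = f ∘ lookup xs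
    ; proper = λ i → f-proper _ (∈-vertices xs i)
    ; meet   = λ i j i~j → Equivalence.to (adj⇔ i j (adjacent⇒distinct i~j)) i~j
    ; apart  = λ i j (i≢j , i≁j) → i≁j ∘ Equivalence.from (adj⇔ i j i≢j)
    }
    where
    adj⇔ : ∀ i j → lookup xs i ≢ lookup xs j →
      Adj G (lookup xs i) (lookup xs j) ⇔ Meet (f (lookup xs i)) (f (lookup xs j))
    adj⇔ i j = adj⇔meet _ _ (∈-vertices xs i) (∈-vertices xs j)

  small-interval-model : Prereduced G → ∀ {k} (xs : Vec (Fin n) k) → k ≤ 10 →
    ¬ ¬ IntervalModel G xs
  small-interval-model prereduced xs k≤10 =
    ¬¬-map (interval-model xs)
      (prereduced⇒¬¬interval G prereduced (vertices xs) (≤-trans (∣vertices∣≤length xs) k≤10))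

private variable
  A B C D : Interval

Meet-sym : Meet A B → Meet B A
Meet-sym (p , q) = q , p

¬Meet⇒hi<lo : ¬ Meet A B → lo A ≤ hi B → hi A < lo B
¬Meet⇒hi<lo {A} {B} ¬AB loA≤hiB with lo B ≤? hi A
... | yes loB≤hiA = contradiction (loA≤hiB , loB≤hiA) ¬AB
... | no  loB≰hiA = ≰⇒> loB≰hiA

¬Meet⇒separated : ¬ Meet A B → hi A < lo B ⊎ hi B < lo A
¬Meet⇒separated {A} {B} ¬AB with lo A ≤? hi B
... | yes loA≤hiB = inj₁ (¬Meet⇒hi<lo ¬AB loA≤hiB)
... | no  loA≰hiB = inj₂ (≰⇒> loA≰hiB)

meet-across-gap : hi A < lo C → Meet A B → Meet B C → Meet A D → Meet D C → Meet B D
meet-across-gap A<C (_ , loB≤hiA) (_ , loC≤hiB) (_ , loD≤hiA) (_ , loC≤hiD) =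
  ≤-trans loB≤hiA (≤-trans (<⇒≤ A<C) loC≤hiD) , ≤-trans loD≤hiA (≤-trans (<⇒≤ A<C) loC≤hiB)

C₄-not-interval : Meet A B → Meet B C → Meet C D → Meet D A → ¬ Meet A C → ¬ Meet B D → Empty
C₄-not-interval ab bc cd da ¬ac ¬bd with ¬Meet⇒separated ¬ac
... | inj₁ A<C = ¬bd (meet-across-gap A<C ab bc (Meet-sym da) (Meet-sym cd))
... | inj₂ C<A = ¬bd (meet-across-gap C<A (Meet-sym bc) (Meet-sym ab) cd da)

-- An interval X meeting V but not W lies beyond W, on the side of V; so an
-- interval meeting W but not X falls short of any interval meeting X.
module Beyond {W V X : Interval} (W-proper : lo W ≤ hi W) (X-proper : lo X ≤ hi X)
  (xv : Meet X V) (¬xw : ¬ Meet X W) where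

  hi<hi : hi W < lo V → ∀ {A B} → Meet A W → ¬ Meet A X → Meet B X → hi A < hi B
  hi<hi W<V {A} aw ¬ax bx = <-≤-trans A<X (proj₂ bx)
    where
    W<X : hi W < lo X
    W<X = ¬Meet⇒hi<lo (¬xw ∘ Meet-sym) (≤-trans W-proper (≤-trans (<⇒≤ W<V) (proj₂ xv)))
    A<X : hi A < lo X
    A<X = ¬Meet⇒hi<lo ¬ax (≤-trans (proj₁ aw) (≤-trans (<⇒≤ W<X) X-proper))

  lo<lo : hi V < lo W → ∀ {A B} → Meet A W → ¬ Meet A X → Meet B X → lo B < lo A
  lo<lo V<W {A} aw ¬ax bx = ≤-<-trans (proj₁ bx) X<A
    where
    X<W : hi X < lo W
    X<W = ¬Meet⇒hi<lo ¬xw (≤-trans (proj₁ xv) (≤-trans (<⇒≤ V<W) W-proper))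
    X<A : hi X < lo A
    X<A = ¬Meet⇒hi<lo (¬ax ∘ Meet-sym) (≤-trans X-proper (≤-trans (<⇒≤ X<W) (proj₂ aw)))

-- In both configurations below {W, P, Q} is an asteroidal triple.
module _ {W V P Q : Interval} (W-proper : lo W ≤ hi W) (P-proper : lo P ≤ hi P)
  (Q-proper : lo Q ≤ hi Q) (¬wv : ¬ Meet W V) (pv : Meet P V) (qv : Meet Q V)
  (¬pw : ¬ Meet P W) (¬qw : ¬ Meet Q W) where

  private
    module P = Beyond W-proper P-proper pv ¬pw
    module Q = Beyond W-proper Q-proper qv ¬qw

  edge-AT-not-interval : ∀ {A B} → Meet A W → Meet B W → Meet P A → Meet B Q →
    ¬ Meet P B → ¬ Meet A Q → Empty
  edge-AT-not-interval aw bw pa bq ¬pb ¬aq with ¬Meet⇒separated ¬wv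
  ... | inj₁ W<V = <-asym (P.hi<hi W<V bw (¬pb ∘ Meet-sym) (Meet-sym pa)) (Q.hi<hi W<V aw ¬aq bq)
  ... | inj₂ V<W = <-asym (P.lo<lo V<W bw (¬pb ∘ Meet-sym) (Meet-sym pa)) (Q.lo<lo V<W aw ¬aq bq)

  vertex-AT-not-interval : ∀ {A B C} → Meet A W → Meet P C → Meet C A → Meet A B → Meet B Q →
    ¬ Meet P A → ¬ Meet C B → ¬ Meet A Q → Empty
  vertex-AT-not-interval aw pc ca ab bq ¬pa ¬cb ¬aq with ¬Meet⇒separated ¬wv
  ... | inj₁ W<V = ¬cb
    ( ≤-trans (proj₁ ca) (<⇒≤ (Q.hi<hi W<V aw ¬aq bq))
    , ≤-trans (proj₂ ab) (<⇒≤ (P.hi<hi W<V aw (¬pa ∘ Meet-sym) (Meet-sym pc))))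
  ... | inj₂ V<W = ¬cb
    ( ≤-trans (<⇒≤ (P.lo<lo V<W aw (¬pa ∘ Meet-sym) (Meet-sym pc))) (proj₁ ab)
    , ≤-trans (<⇒≤ (Q.lo<lo V<W aw ¬aq bq)) (proj₂ ca))

-- Succ {k} read on the underlying naturals, so that its equations can be
-- matched on.
Step : ℕ → ℕ → ℕ → Set
Step k a b = (b ≡ suc a) ⊎ ((suc a ≡ k) × (b ≡ 0))

two-steps-apart : ∀ {k a b c} → 4 ≤ k → Step k a b → Step k b c →
  ¬ (Step k a c ⊎ Step k c a) × a ≢ c
two-steps-apart (s≤s (s≤s (s≤s (s≤s _)))) (inj₁ refl) (inj₁ refl) =
  (λ { (inj₁ (inj₁ ())) ; (inj₁ (inj₂ (_ , ()))) ; (inj₂ (inj₁ ())) ; (inj₂ (inj₂ (() , refl))) }) , λ ()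
two-steps-apart (s≤s (s≤s (s≤s (s≤s _)))) (inj₁ refl) (inj₂ (refl , refl)) =
  (λ { (inj₁ (inj₁ ())) ; (inj₁ (inj₂ (() , _))) ; (inj₂ (inj₁ ())) ; (inj₂ (inj₂ (() , _))) }) , λ ()
two-steps-apart (s≤s (s≤s (s≤s (s≤s _)))) (inj₂ (refl , refl)) (inj₁ refl) =
  (λ { (inj₁ (inj₁ ())) ; (inj₁ (inj₂ (_ , ()))) ; (inj₂ (inj₁ ())) ; (inj₂ (inj₂ (() , _))) }) , λ ()
two-steps-apart (s≤s (s≤s _)) (inj₂ (refl , refl)) (inj₂ (() , _))

successor : ∀ {k} (i : Fin k) → ∃ (Succ i)
successor {suc k} i with suc (toℕ i) <? suc k
... | yes i+1<1+k = fromℕ< i+1<1+k , inj₁ (toℕ-fromℕ< i+1<1+k)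
... | no  i+1≮1+k = zero , inj₂ (≤-antisym (toℕ<n i) (≮⇒≥ i+1≮1+k) , refl)

predecessor : ∀ {k} (i : Fin k) → ∃ λ j → Succ j i
predecessor {suc k} zero = fromℕ k , inj₂ (cong suc (toℕ-fromℕ k) , refl)
predecessor (suc i)      = inject₁ i , inj₁ (cong suc (≡-sym (toℕ-inject₁ i)))

module _ {n} {G : Graph n} (H : Hole G) where

  hole-edge : ∀ {a b} → Succ a b → Adj G (cyc H a) (cyc H b)
  hole-edge {a} {b} a→b = Equivalence.from (induced H a b) (inj₁ a→b)

  hole-gap : ∀ {a b c} → Succ a b → Succ b c → Independent G (cyc H a) (cyc H c)
  hole-gap {a} {b} {c} a→b b→c =
    (distinct ∘ cong toℕ ∘ cyc-inj H) , (nonadjacent ∘ Equivalence.to (induced H a c))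
    where
    nonadjacent : ¬ CycAdj a c
    nonadjacent = proj₁ (two-steps-apart (len≥4 H) a→b b→c)
    distinct : toℕ a ≢ toℕ c
    distinct = proj₂ (two-steps-apart (len≥4 H) a→b b→c)

module _ {n} {G : Graph n} (prereduced : Prereduced G) (H : Hole G) {v w : Fin n}
  (v~hole : ∀ i → Adj G v (cyc H i)) (w≢v : w ≢ v) (v≁w : ¬ Adj G v w) where

  private
    h : Fin (len H) → Fin n
    h = cyc H

    h~v : ∀ i → Adj G (h i) v
    h~v i = sym G (v~hole i)

    w∥v : Independent G w v
    w∥v = w≢v , v≁w ∘ sym G

    small-model : ∀ {k} (xs : Vec (Fin n) k) → k ≤ 10 → ¬ ¬ IntervalModel G xs
    small-model = small-interval-model prereduced

    h∥w : ∀ {i} → ¬ Adj G (h i) w → Independent G (h i) w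
    h∥w {i} i≁w = (λ { refl → v≁w (v~hole i) }) , i≁w

  w≁two-apart : ∀ {a b c} → Succ a b → Succ b c → Adj G (h a) w → Adj G (h c) w → Empty
  w≁two-apart {a} {b} {c} a→b b→c a~w c~w =
    small-model (w ∷ h a ∷ v ∷ h c ∷ []) (m≤m+n 4 6) λ M →
    let open IntervalModel M in
    C₄-not-interval (meet (# 0) (# 1) (sym G a~w)) (meet (# 1) (# 2) (h~v a))
                    (meet (# 2) (# 3) (v~hole c)) (meet (# 3) (# 0) c~w)
                    (apart (# 0) (# 2) w∥v) (apart (# 1) (# 3) (hole-gap H a→b b→c))

  w≁edge : ∀ {p a b q} → Succ p a → Succ a b → Succ b q → Adj G (h a) w → Adj G (h b) w → Empty
  w≁edge {p} {a} {b} {q} p→a a→b b→q a~w b~w =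
    small-model (w ∷ v ∷ h p ∷ h q ∷ h a ∷ h b ∷ []) (m≤m+n 6 4) λ M →
    let open IntervalModel M in
    edge-AT-not-interval (proper (# 0)) (proper (# 2)) (proper (# 3)) (apart (# 0) (# 1) w∥v)
      (meet (# 2) (# 1) (h~v p)) (meet (# 3) (# 1) (h~v q))
      (apart (# 2) (# 0) (h∥w p≁w)) (apart (# 3) (# 0) (h∥w q≁w))
      (meet (# 4) (# 0) a~w) (meet (# 5) (# 0) b~w)
      (meet (# 2) (# 4) (hole-edge H p→a)) (meet (# 5) (# 3) (hole-edge H b→q))
      (apart (# 2) (# 5) (hole-gap H p→a a→b)) (apart (# 4) (# 3) (hole-gap H a→b b→q))
    where
    p≁w : ¬ Adj G (h p) w
    p≁w p~w = w≁two-apart p→a a→b p~w b~w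
    q≁w : ¬ Adj G (h q) w
    q≁w q~w = w≁two-apart a→b b→q a~w q~w

  w≁lone : ∀ {c₂ c a b b₂} → Succ c₂ c → Succ c a → Succ a b → Succ b b₂ →
    Adj G (h a) w → ¬ Adj G (h c) w → ¬ Adj G (h b) w → Empty
  w≁lone {c₂} {c} {a} {b} {b₂} c₂→c c→a a→b b→b₂ a~w c≁w b≁w =
    small-model (w ∷ v ∷ h c₂ ∷ h b₂ ∷ h a ∷ h b ∷ h c ∷ []) (m≤m+n 7 3) λ M →
    let open IntervalModel M in
    vertex-AT-not-interval (proper (# 0)) (proper (# 2)) (proper (# 3)) (apart (# 0) (# 1) w∥v)
      (meet (# 2) (# 1) (h~v c₂)) (meet (# 3) (# 1) (h~v b₂))
      (apart (# 2) (# 0) (h∥w c₂≁w)) (apart (# 3) (# 0) (h∥w b₂≁w))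
      (meet (# 4) (# 0) a~w) (meet (# 2) (# 6) (hole-edge H c₂→c)) (meet (# 6) (# 4) (hole-edge H c→a))
      (meet (# 4) (# 5) (hole-edge H a→b)) (meet (# 5) (# 3) (hole-edge H b→b₂))
      (apart (# 2) (# 4) (hole-gap H c₂→c c→a)) (apart (# 6) (# 5) (hole-gap H c→a a→b))
      (apart (# 4) (# 3) (hole-gap H a→b b→b₂))
    where
    c₂≁w : ¬ Adj G (h c₂) w
    c₂≁w c₂~w = w≁two-apart c₂→c c→a c₂~w a~w
    b₂≁w : ¬ Adj G (h b₂) w
    b₂≁w b₂~w = w≁two-apart a→b b→b₂ a~w b₂~w

  w≁hole : ∀ i → ¬ Adj G (h i) w
  w≁hole i i~w with predecessor i | successor i
  ... | p , p→i | s , i→s with predecessor p | successor s | adj? G (h p) w | adj? G (h s) w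
  ... | _  , _    | _  , _    | yes p~w | yes s~w = w≁two-apart p→i i→s p~w s~w
  ... | _  , _    | s′ , s→s′ | no  _   | yes s~w = w≁edge p→i i→s s→s′ i~w s~w
  ... | p′ , p′→p | _  , _    | yes p~w | no  _   = w≁edge p′→p p→i i→s p~w i~w
  ... | p′ , p′→p | s′ , s→s′ | no  p≁w | no  s≁w = w≁lone p′→p p→i i→s s→s′ i~w p≁w s≁w

corollary6p3 : ∀ {n} (G : Graph n) → Prereduced G → (H : Hole G) → (v : Fin n) →
    (∀ w → InHole H w → Adj G v w) →
    ∀ w → InClosedNbhd H w → w ≢ v → Adj G v w
corollary6p3 G prereduced H v v~hole w (i , inj₁ refl) w≢v = v~hole w (i , refl)
corollary6p3 G prereduced H v v~hole w (i , inj₂ i~w) w≢v with adj? G v w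
... | yes v~w = v~w
... | no  v≁w = ⊥-elim (w≁hole prereduced H (λ j → v~hole _ (j , refl)) w≢v v≁w i i~w)
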